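{- Let $\ell \in \mathbb{Z}_{\geq 0}$ and $m \in \mathbb{Z}$, and let $\chi_{6,0}$ denote the principal character modulo $6$. Then \[ \Lambda_{\ell,m,6}\vert U_4\otimes \chi_{6,0} = \begin{cases} 2^{\ell+1}G_{\ell,1,3}\vert S_{6,5}&\text{if }m \equiv 0 \pmod{6},\\ 0&\text{if }m \equiv 1,3,5 \pmod{6},\\ 2^\ell G_{\ell,1,3}\vert S_{6,1}+2^{\ell-1}T_{\ell,1,6}&\text{if }m \equiv 2,4 \pmod{6}, \end{cases} \] where $\Lambda\vert U_4\otimes\chi$ means $(\Lambda\vert U_4)\otimes\chi$.
   Context: Write $q = e^{2\pi i\tau}$. For $F = \sum_n a(n)q^n$: $F\vert U_M := \sum_n a(Mn)q^n$; for a Dirichlet character $\psi$, $F\otimes\psi := \sum_n \psi(n)a(n)q^n$; the sieving operator is $F\vert S_{M,m} := \sum_{n \in \mathbb{Z}} a(Mn+m)q^{Mn+m}$. For $\ell\in\mathbb{Z}_{\geq0}$, $m\in\mathbb{Z}$, $M\in\mathbb{Z}_{\geq1}$: $\Lambda_{\ell,m,M}(\tau) := \sum_{n\geq1}\lambda_{\ell,m,M}(n)q^n$ with $\lambda_{\ell,m,M}(n) := \sum_{\pm}\sum^{*}(t-s)^\ell$, where the inner sum is over integers $t>s\geq 0$ with $t^2-s^2=n$ and $t\equiv \pm m \pmod M$, the outer sum is over the two signs, and the $*$ means that terms with $s=0$ are counted with weight $\frac12$. Further $G_{\ell,m,M}(\tau) := \sum_{n\geq 1} g_{\ell,m,M}(n)q^n$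 with $g_{\ell,m,M}(n) := \sum_{\pm}\sum_{d \mid n,\ 0<d<\sqrt{n},\ d\equiv \pm m \pmod{M}} d^\ell$, and $T_{\ell,m,M}(\tau) := \sum_{\pm}\sum_{n\geq 1,\ n \equiv \pm m \pmod{M}} n^\ell q^{n^2}$. -}

module Defs where

open import Data.Nat as ℕ using (ℕ; zero; suc; NonZero; _∸_; _≟_; _<?_)
open import Data.Nat.Divisibility using (_∣?_)
open import Data.Nat.GCD using (gcd)
open import Data.Integer as ℤ using (ℤ; +_; ∣_∣)
open import Data.Rational as ℚ using (ℚ; 0ℚ; ½; _+_; _*_; _/_)
open import Data.List using (List; []; _∷_; upTo)
open import Data.Bool using (Bool; true; false; if_then_else_)
open import Relation.Nullary.Decidable using (⌊_⌋)

-- q-series, represented by their coefficient sequences a(0), a(1), ...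
QSeries : Set
QSeries = ℕ → ℚ

ℕ→ℚ : ℕ → ℚ
ℕ→ℚ n = + n / 1

sumℚ : (ℕ → ℚ) → List ℕ → ℚ
sumℚ f []       = 0ℚ
sumℚ f (x ∷ xs) = f x + sumℚ f xs

sumTo : ℕ → (ℕ → ℚ) → ℚ
sumTo n f = sumℚ f (upTo (suc n))

[_]_ : Bool → ℚ → ℚ
[ b ] x = if b then x else 0ℚ
infixr 5 [_]_

congB : ℕ → ℤ → ℕ → Bool
congB t m M = ⌊ M ∣? ∣ (+ t) ℤ.- m ∣ ⌋

-- λ_{ℓ,m,M}(n) = Σ_± Σ* _{t>s≥0, t²-s²=n, t ≡ ±m (M)} (t-s)^ℓ,
-- with s = 0 terms weighted ½.  (t ≤ n automatically when n ≥ 1.)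
lamCoeff : ℕ → ℤ → ℕ → ℕ → ℚ
lamCoeff ℓ m M n = signed m + signed (ℤ.- m)
  where
  signed : ℤ → ℚ
  signed m' = sumTo n λ t → sumTo n λ s →
    [ ⌊ s <? t ⌋ Data.Bool.∧ ⌊ t ℕ.* t ≟ s ℕ.* s ℕ.+ n ⌋ Data.Bool.∧ congB t m' M ]
      ((if ⌊ s ≟ 0 ⌋ then ½ else ℚ.1ℚ) * ℕ→ℚ ((t ∸ s) ℕ.^ ℓ))

Λ : ℕ → ℤ → ℕ → QSeries
Λ ℓ m M = lamCoeff ℓ m M

gCoeff : ℕ → ℤ → ℕ → ℕ → ℚ
gCoeff ℓ m M n = signed m + signed (ℤ.- m)
  where
  signed : ℤ → ℚ
  signed m' = sumTo n λ d →
    [ ⌊ 0 <? d ⌋ Data.Bool.∧ ⌊ d ∣? n ⌋ Data.Bool.∧ ⌊ d ℕ.* d <? n ⌋ Data.Bool.∧ congB d m' M ]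
      ℕ→ℚ (d ℕ.^ ℓ)

G : ℕ → ℤ → ℕ → QSeries
G ℓ m M = gCoeff ℓ m M

-- T_{ℓ,m,M} = Σ_± Σ_{k ≥ 1, k ≡ ±m (M)} k^ℓ q^{k²}; coefficient at N
tCoeff : ℕ → ℤ → ℕ → ℕ → ℚ
tCoeff ℓ m M N = signed m + signed (ℤ.- m)
  where
  signed : ℤ → ℚ
  signed m' = sumTo N λ k →
    [ ⌊ 0 <? k ⌋ Data.Bool.∧ ⌊ k ℕ.* k ≟ N ⌋ Data.Bool.∧ congB k m' M ]
      ℕ→ℚ (k ℕ.^ ℓ)

T : ℕ → ℤ → ℕ → QSeries
T ℓ m M = tCoeff ℓ m M

_∣U_ : QSeries → ℕ → QSeries
(F ∣U M) n = F (M ℕ.* n)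

_⊗_ : QSeries → (ℕ → ℚ) → QSeries
(F ⊗ ψ) n = ψ n * F n

S : ℕ → ℤ → QSeries → QSeries
S M r F N = [ congB N r M ] F N

χ₆₀ : ℕ → ℚ
χ₆₀ n = [ ⌊ gcd n 6 ≟ 1 ⌋ ] ℚ.1ℚ

_⊕_ : QSeries → QSeries → QSeries
(F ⊕ H) n = F n + H n

_·_ : ℚ → QSeries → QSeries
(c · F) n = c * F n

zeroS : QSeries
zeroS _ = 0ℚ

2^ : ℕ → ℚ
2^ k = ℕ→ℚ (2 ℕ.^ k)

infixl 6 _⊕_
infixr 7 _·_
infixl 8 _∣U_
infixl 7 _⊗_

{-# OPTIONS --safe #-}
-- If t > s ≥ 0 and t² − s² = 4n, then 2 ∣ (t − s)(t + s) forces t ≡ s (mod 2), so t − s = 2d and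
-- t + s = 2e with n = de and d ≤ e.  This matches the terms of λ(4n) with the divisors d ≤ √n of n;
-- then t = d + e, (t − s)^ℓ = 2^ℓ d^ℓ, and s = 0 exactly when d² = n.  Every ± sum weighs a term
-- by the number of signs ε with x ≡ εm, which depends only on residues mod 6.  If χ₆₀(n) ≠ 0 then
-- d, e ≡ ±1 (mod 6): n ≡ 5 forces d + e ≡ 0, while n ≡ 1 forces d + e ≡ ±2 and d ≡ ±1 (mod 3).
-- So the two sides agree summand by summand, a finite check on residues done by evaluation.

module Submission where

open import Defs
open import Data.Nat using (ℕ; suc)
open import Data.Integer using (ℤ; +_; _%ℕ_)
open import Data.Rational using (ℚ; ½; _*_)
open import Data.Product using (_×_)
open import Data.Sum using (_⊎_)
open import Relation.Binary.PropositionalEquality using (_≡_)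

open import Algebra.Bundles using (CommutativeMonoid)
import Algebra.Properties.CommutativeSemigroup as CommutativeSemigroupProperties
open import Data.Bool using (Bool; true; false; _∧_; if_then_else_)
open import Data.Bool.Properties using (T-≡; ∧-assoc)
open import Data.Empty using (⊥; ⊥-elim)
open import Data.Fin using (Fin; toℕ; fromℕ<)
open import Data.Fin.Properties using (all?; toℕ-fromℕ<)
open import Data.List using ([]; _∷_; upTo; _++_)
open import Data.List.Properties using (upTo-∷ʳ)
open import Data.Nat as ℕ using (zero; NonZero; _∸_; _^_; _<_; _≤_; _≟_; _<?_; _≤?_; s≤s)
open import Data.Nat.Coprimality using (1-coprimeTo) renaming (sym to coprime-sym)
open import Data.Nat.DivMod using (_/_; _%_; m*n/n≡m; m≡m%n+[m/n]*n; m%n<n; %-distribˡ-+; %-distribˡ-*; m∣n⇒o%n%m≡o%m)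
open import Data.Nat.Divisibility as ℕᵈ using (_∣_; _∣?_; divides; divides-refl; ∣m+n∣m⇒∣n; m∣m*n; ∣-antisym; %-presˡ-∣; ∣n∣m%n⇒∣m)
open import Data.Nat.GCD using (gcd; gcd[m,n]∣m; gcd[m,n]∣n; gcd-greatest)
open import Data.Nat.Primality using (Prime; prime?; euclidsLemma)
import Data.Nat.Properties as ℕₚ
open import Data.Nat.Tactic.RingSolver using (solve-∀)
open import Data.Integer as ℤ using (_/ℕ_; _-_)
open import Data.Integer.DivMod using (a≡a%ℕn+[a/ℕn]*n)
open import Data.Integer.Divisibility.Signed as ℤᵈ using (∣ᵤ⇒∣; ∣⇒∣ᵤ; ∣m∣n⇒∣m+n; ∣m∣n⇒∣m-n; ∣m+n∣n⇒∣m; ∣m⇒∣-m)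
import Data.Integer.Properties as ℤₚ
import Data.Integer.Tactic.RingSolver as ℤ-Solver
open import Data.Rational as ℚ using (0ℚ; 1ℚ; mkℚ; _+_)
import Data.Rational.Properties as ℚₚ
open import Data.Rational.Solver using (module +-*-Solver)
open import Data.Product using (_,_; proj₂; ∃-syntax)
open import Data.Sum using (inj₁; inj₂)
open import Function.Base using (case_of_)
open import Function.Bundles using (Equivalence; _⇔_; mk⇔)
open import Relation.Binary.Definitions using (tri<; tri≈; tri>)
open import Relation.Binary.PropositionalEquality using (refl; sym; trans; cong; cong₂; subst; subst₂; module ≡-Reasoning)
open import Relation.Nullary using (¬_; yes; no)
open import Relation.Nullary.Decidable using (Dec; True; ⌊_⌋; isYes≗does; dec-true; dec-false; does-⇔; toWitness; from-yes)
open +-*-Solver using (solve; _:=_; _:*_; _:+_; con)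
open CommutativeSemigroupProperties (CommutativeMonoid.commutativeSemigroup ℚₚ.+-0-commutativeMonoid)
  using () renaming (interchange to +-interchange)
open ≡-Reasoning

⌊⌋-true : ∀ {P : Set} (P? : Dec P) → P → ⌊ P? ⌋ ≡ true
⌊⌋-true P? p = trans (isYes≗does P?) (dec-true P? p)

⌊⌋-false : ∀ {P : Set} (P? : Dec P) → ¬ P → ⌊ P? ⌋ ≡ false
⌊⌋-false P? ¬p = trans (isYes≗does P?) (dec-false P? ¬p)

⌊⌋-sound : ∀ {P : Set} (P? : Dec P) → ⌊ P? ⌋ ≡ true → P
⌊⌋-sound P? holds = toWitness {a? = P?} (Equivalence.from T-≡ holds)

⌊⌋-⇔ : ∀ {P Q : Set} → P ⇔ Q → (P? : Dec P) (Q? : Dec Q) → ⌊ P? ⌋ ≡ ⌊ Q? ⌋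
⌊⌋-⇔ P⇔Q P? Q? = trans (isYes≗does P?) (trans (does-⇔ P⇔Q P? Q?) (sym (isYes≗does Q?)))

∧-true : ∀ b {c} → b ∧ c ≡ true → b ≡ true × c ≡ true
∧-true true {true} refl = refl , refl

∑< : ℕ → (ℕ → ℚ) → ℚ
∑< n f = sumℚ f (upTo n)

syntax ∑< n (λ x → e) = ∑[ x < n ] e

sumℚ-++ : ∀ f xs ys → sumℚ f (xs ++ ys) ≡ sumℚ f xs + sumℚ f ys
sumℚ-++ f []       ys = sym (ℚₚ.+-identityˡ _)
sumℚ-++ f (x ∷ xs) ys = trans (cong (λ r → f x + r) (sumℚ-++ f xs ys)) (sym (ℚₚ.+-assoc (f x) _ _))

∑-suc : ∀ n f → ∑< (suc n) f ≡ ∑< n f + f n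
∑-suc n f = begin
  sumℚ f (upTo (suc n))         ≡⟨ cong (sumℚ f) (upTo-∷ʳ n) ⟨
  sumℚ f (upTo n ++ (n ∷ []))   ≡⟨ sumℚ-++ f (upTo n) (n ∷ []) ⟩
  ∑< n f + (f n + 0ℚ)           ≡⟨ cong (λ r → ∑< n f + r) (ℚₚ.+-identityʳ (f n)) ⟩
  ∑< n f + f n                  ∎

∑-cong : ∀ n {f g} → (∀ x → x < n → f x ≡ g x) → ∑< n f ≡ ∑< n g
∑-cong zero    f≗g = refl
∑-cong (suc n) {f} {g} f≗g = begin
  ∑< (suc n) f   ≡⟨ ∑-suc n f ⟩
  ∑< n f + f n   ≡⟨ cong₂ _+_ (∑-cong n λ x x<n → f≗g x (ℕₚ.m<n⇒m<1+n x<n)) (f≗g n ℕₚ.≤-refl) ⟩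
  ∑< n g + g n   ≡⟨ ∑-suc n g ⟨
  ∑< (suc n) g   ∎

∑-zero : ∀ n {f} → (∀ x → x < n → f x ≡ 0ℚ) → ∑< n f ≡ 0ℚ
∑-zero zero    f≗0 = refl
∑-zero (suc n) {f} f≗0 = begin
  ∑< (suc n) f   ≡⟨ ∑-suc n f ⟩
  ∑< n f + f n   ≡⟨ cong₂ _+_ (∑-zero n λ x x<n → f≗0 x (ℕₚ.m<n⇒m<1+n x<n)) (f≗0 n ℕₚ.≤-refl) ⟩
  0ℚ             ∎

∑-+ : ∀ n f g → ∑[ x < n ] (f x + g x) ≡ ∑< n f + ∑< n g
∑-+ zero    f g = refl
∑-+ (suc n) f g = begin
  ∑[ x < suc n ] (f x + g x)               ≡⟨ ∑-suc n _ ⟩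
  ∑[ x < n ] (f x + g x) + (f n + g n)     ≡⟨ cong (_+ (f n + g n)) (∑-+ n f g) ⟩
  (∑< n f + ∑< n g) + (f n + g n)          ≡⟨ +-interchange (∑< n f) (∑< n g) (f n) (g n) ⟩
  (∑< n f + f n) + (∑< n g + g n)          ≡⟨ cong₂ _+_ (∑-suc n f) (∑-suc n g) ⟨
  ∑< (suc n) f + ∑< (suc n) g              ∎

∑-*ˡ : ∀ n c f → c * ∑< n f ≡ ∑[ x < n ] (c * f x)
∑-*ˡ zero    c f = ℚₚ.*-zeroʳ c
∑-*ˡ (suc n) c f = begin
  c * ∑< (suc n) f               ≡⟨ cong (c *_) (∑-suc n f) ⟩
  c * (∑< n f + f n)             ≡⟨ ℚₚ.*-distribˡ-+ c (∑< n f) (f n) ⟩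
  c * ∑< n f + c * f n           ≡⟨ cong (_+ c * f n) (∑-*ˡ n c f) ⟩
  ∑[ x < n ] (c * f x) + c * f n ≡⟨ ∑-suc n _ ⟨
  ∑[ x < suc n ] (c * f x)       ∎

∑-swap : ∀ m n (h : ℕ → ℕ → ℚ) → ∑[ x < m ] ∑[ y < n ] h x y ≡ ∑[ y < n ] ∑[ x < m ] h x y
∑-swap zero    n h = sym (∑-zero n λ _ _ → refl)
∑-swap (suc m) n h = begin
  ∑[ x < suc m ] ∑< n (h x)                        ≡⟨ ∑-suc m _ ⟩
  ∑[ x < m ] ∑< n (h x) + ∑< n (h m)               ≡⟨ cong (_+ ∑< n (h m)) (∑-swap m n h) ⟩
  ∑[ y < n ] ∑[ x < m ] h x y + ∑< n (h m)         ≡⟨ ∑-+ n _ _ ⟨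
  ∑[ y < n ] (∑[ x < m ] h x y + h m y)            ≡⟨ ∑-cong n (λ y _ → ∑-suc m (λ x → h x y)) ⟨
  ∑[ y < n ] ∑[ x < suc m ] h x y                  ∎

∑-δ : ∀ n {c} v → c < n → ∑[ y < n ] ([ ⌊ y ≟ c ⌋ ] v) ≡ v
∑-δ (suc n) {c} v c<1+n with ℕₚ.m≤n⇒m<n∨m≡n (ℕₚ.<⇒≤pred c<1+n)
... | inj₁ c<n = begin
  ∑[ y < suc n ] ([ ⌊ y ≟ c ⌋ ] v)                ≡⟨ ∑-suc n _ ⟩
  ∑[ y < n ] ([ ⌊ y ≟ c ⌋ ] v) + ([ ⌊ n ≟ c ⌋ ] v)
    ≡⟨ cong₂ _+_ (∑-δ n v c<n) (cong ([_] v) (⌊⌋-false (n ≟ c) (ℕₚ.>⇒≢ c<n))) ⟩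
  v + 0ℚ                                          ≡⟨ ℚₚ.+-identityʳ v ⟩
  v                                               ∎
... | inj₂ refl = begin
  ∑[ y < suc n ] ([ ⌊ y ≟ n ⌋ ] v)                ≡⟨ ∑-suc n _ ⟩
  ∑[ y < n ] ([ ⌊ y ≟ n ⌋ ] v) + ([ ⌊ n ≟ n ⌋ ] v)
    ≡⟨ cong₂ _+_ (∑-zero n λ y y<n → cong ([_] v) (⌊⌋-false (y ≟ n) (ℕₚ.<⇒≢ y<n))) (cong ([_] v) (⌊⌋-true (n ≟ n) refl)) ⟩
  0ℚ + v                                          ≡⟨ ℚₚ.+-identityˡ v ⟩
  v                                               ∎

𝟙 : Bool → ℚ
𝟙 b = [ b ] 1ℚ

[]≡𝟙* : ∀ b x → [ b ] x ≡ 𝟙 b * x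
[]≡𝟙* true  x = sym (ℚₚ.*-identityˡ x)
[]≡𝟙* false x = sym (ℚₚ.*-zeroˡ x)

[]-∧ : ∀ b c x → [ b ∧ c ] x ≡ [ b ] [ c ] x
[]-∧ true  c x = refl
[]-∧ false c x = refl

[]-off : ∀ {b} x → (b ≡ true → ⊥) → [ b ] x ≡ 0ℚ
[]-off {true}  x b≢true = ⊥-elim (b≢true refl)
[]-off {false} x b≢true = refl

[]-cong : ∀ {b c x y} → (b ≡ true → c ≡ true × x ≡ y) → (c ≡ true → b ≡ true) → [ b ] x ≡ [ c ] y
[]-cong {true} to from with to refl
... | refl , x≡y = x≡y
[]-cong {false} {false} to from = refl
[]-cong {false} {true}  to from with from refl
... | ()

-- Reindexing a double sum along a bijection

-- Each (x, z)-term is placed over y = ψ x z; after swapping the sums, the terms over y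
-- collapse to the single pair (φ₁ y, φ₂ y).
module _ (A B : ℕ) (p : ℕ → ℕ → Bool) (f : ℕ → ℕ → ℚ) (q : ℕ → Bool) (g : ℕ → ℚ)
         (ψ : ℕ → ℕ → ℕ) (φ₁ φ₂ : ℕ → ℕ)
         (to : ∀ x z → x < A → z < A → p x z ≡ true →
               ∃[ y ] (y < B × ψ x z ≡ y × φ₁ y ≡ x × φ₂ y ≡ z × q y ≡ true × g y ≡ f x z))
         (from : ∀ y → y < B → q y ≡ true →
               φ₁ y < A × φ₂ y < A × ψ (φ₁ y) (φ₂ y) ≡ y × p (φ₁ y) (φ₂ y) ≡ true)
         where

  private
    placed : ℕ → ℕ → ℕ → ℚ
    placed x z y = [ p x z ∧ ⌊ y ≟ ψ x z ⌋ ] f x z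

    spread : ∀ x z → x < A → z < A → [ p x z ] f x z ≡ ∑[ y < B ] placed x z y
    spread x z x<A z<A with p x z in pxz
    ... | false = sym (∑-zero B λ _ _ → refl)
    ... | true  = let (y , y<B , ψ≡y , _) = to x z x<A z<A pxz in sym (∑-δ B (f x z) (subst (_< B) (sym ψ≡y) y<B))

    graph : ∀ y x z → y < B → x < A → z < A → q y ≡ true →
            placed x z y ≡ [ ⌊ z ≟ φ₂ y ⌋ ] ([ ⌊ x ≟ φ₁ y ⌋ ] g y)
    graph y x z y<B x<A z<A qy = trans ([]-cong forward backward) ([]-∧ ⌊ z ≟ φ₂ y ⌋ ⌊ x ≟ φ₁ y ⌋ (g y))
      where
      forward : p x z ∧ ⌊ y ≟ ψ x z ⌋ ≡ true → ⌊ z ≟ φ₂ y ⌋ ∧ ⌊ x ≟ φ₁ y ⌋ ≡ true × f x z ≡ g y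
      forward holds with ∧-true (p x z) holds
      ... | pxz , y≟ψ with to x z x<A z<A pxz | ⌊⌋-sound (y ≟ ψ x z) y≟ψ
      ... | _ , _ , refl , φ₁y≡x , φ₂y≡z , _ , gy≡f | refl =
        cong₂ _∧_ (⌊⌋-true (z ≟ _) (sym φ₂y≡z)) (⌊⌋-true (x ≟ _) (sym φ₁y≡x)) , sym gy≡f
      backward : ⌊ z ≟ φ₂ y ⌋ ∧ ⌊ x ≟ φ₁ y ⌋ ≡ true → p x z ∧ ⌊ y ≟ ψ x z ⌋ ≡ true
      backward holds with ∧-true ⌊ z ≟ φ₂ y ⌋ holds
      ... | z≟φ₂y , x≟φ₁y with ⌊⌋-sound (z ≟ φ₂ y) z≟φ₂y | ⌊⌋-sound (x ≟ φ₁ y) x≟φ₁y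
      ... | refl | refl with from y y<B qy
      ... | _ , _ , ψφ≡y , pφ = cong₂ _∧_ pφ (⌊⌋-true (y ≟ _) (sym ψφ≡y))

    outside : ∀ y x z → x < A → z < A → q y ≡ false → placed x z y ≡ 0ℚ
    outside y x z x<A z<A qy = []-off (f x z) λ holds →
      let (pxz , y≟ψ) = ∧-true (p x z) holds
          (_ , _ , ψ≡y₀ , _ , _ , qy₀ , _) = to x z x<A z<A pxz
          y≡y₀ = trans (⌊⌋-sound (y ≟ ψ x z) y≟ψ) ψ≡y₀
      in case trans (sym qy) (trans (cong q y≡y₀) qy₀) of λ ()

    collapse : ∀ y → y < B → ∑[ x < A ] ∑[ z < A ] placed x z y ≡ [ q y ] g y
    collapse y y<B with q y in qy
    ... | false = ∑-zero A λ x x<A → ∑-zero A λ z z<A → outside y x z x<A z<A qy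
    ... | true  = let (φ₁y<A , φ₂y<A , _) = from y y<B qy in begin
      ∑[ x < A ] ∑[ z < A ] placed x z y
        ≡⟨ ∑-cong A (λ x x<A → ∑-cong A λ z z<A → graph y x z y<B x<A z<A qy) ⟩
      ∑[ x < A ] ∑[ z < A ] ([ ⌊ z ≟ φ₂ y ⌋ ] ([ ⌊ x ≟ φ₁ y ⌋ ] g y))
        ≡⟨ ∑-cong A (λ x _ → ∑-δ A _ φ₂y<A) ⟩
      ∑[ x < A ] ([ ⌊ x ≟ φ₁ y ⌋ ] g y)
        ≡⟨ ∑-δ A (g y) φ₁y<A ⟩
      g y ∎

  ∑-reindex₂ : ∑[ x < A ] ∑[ z < A ] ([ p x z ] f x z) ≡ ∑[ y < B ] ([ q y ] g y)
  ∑-reindex₂ = begin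
    ∑[ x < A ] ∑[ z < A ] ([ p x z ] f x z)    ≡⟨ ∑-cong A (λ x x<A → ∑-cong A λ z z<A → spread x z x<A z<A) ⟩
    ∑[ x < A ] ∑[ z < A ] ∑[ y < B ] placed x z y   ≡⟨ ∑-cong A (λ x _ → ∑-swap A B (placed x)) ⟩
    ∑[ x < A ] ∑[ y < B ] ∑[ z < A ] placed x z y   ≡⟨ ∑-swap A B (λ x y → ∑[ z < A ] placed x z y) ⟩
    ∑[ y < B ] ∑[ x < A ] ∑[ z < A ] placed x z y   ≡⟨ ∑-cong B collapse ⟩
    ∑[ y < B ] ([ q y ] g y)                   ∎

-- Writing 4n as a difference of two squares

infixl 7 _÷_

-- Division with the junk value n ÷ 0 = 0; it is only ever used at divisors d > 0.
_÷_ : ℕ → ℕ → ℕ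
n ÷ zero  = zero
n ÷ suc d = n / suc d

*-÷-cancelʳ : ∀ k {d} → 0 < d → (k ℕ.* d) ÷ d ≡ k
*-÷-cancelʳ k {suc d} _ = m*n/n≡m k (suc d)

∣⇒≡*÷ : ∀ {d n} → 0 < d → d ∣ n → n ≡ d ℕ.* (n ÷ d)
∣⇒≡*÷ {d} 0<d (divides-refl k) = trans (ℕₚ.*-comm k d) (cong (d ℕ.*_) (sym (*-÷-cancelʳ k 0<d)))

2-prime : Prime 2
2-prime = from-yes (prime? 2)

gap-product : ∀ {n t s} → s ≤ t → t ℕ.* t ≡ s ℕ.* s ℕ.+ 4 ℕ.* n → (t ∸ s) ℕ.* (2 ℕ.* s ℕ.+ (t ∸ s)) ≡ 4 ℕ.* n
gap-product {n} {t} {s} s≤t t²≡s²+4n = ℕₚ.+-cancelˡ-≡ (s ℕ.* s) _ _ (begin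
  s ℕ.* s ℕ.+ a ℕ.* (2 ℕ.* s ℕ.+ a)  ≡⟨ square-of-sum s a ⟨
  (s ℕ.+ a) ℕ.* (s ℕ.+ a)            ≡⟨ cong (λ x → x ℕ.* x) (ℕₚ.m+[n∸m]≡n s≤t) ⟩
  t ℕ.* t                            ≡⟨ t²≡s²+4n ⟩
  s ℕ.* s ℕ.+ 4 ℕ.* n                ∎)
  where
  a : ℕ
  a = t ∸ s
  square-of-sum : ∀ s a → (s ℕ.+ a) ℕ.* (s ℕ.+ a) ≡ s ℕ.* s ℕ.+ a ℕ.* (2 ℕ.* s ℕ.+ a)
  square-of-sum = solve-∀

even-gap : ∀ {n s} a → a ℕ.* (2 ℕ.* s ℕ.+ a) ≡ 4 ℕ.* n → 2 ∣ a
even-gap {n} {s} a a[2s+a]≡4n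
  with euclidsLemma a (2 ℕ.* s ℕ.+ a) 2-prime (subst (2 ∣_) (sym a[2s+a]≡4n) (ℕᵈ.∣-trans (divides 2 refl) (m∣m*n n)))
... | inj₁ 2∣a    = 2∣a
... | inj₂ 2∣2s+a = ∣m+n∣m⇒∣n 2∣2s+a (m∣m*n s)

difference-of-squares : ∀ {n t s} → s < t → t ℕ.* t ≡ s ℕ.* s ℕ.+ 4 ℕ.* n →
                        ∃[ d ] (0 < d × t ≡ 2 ℕ.* d ℕ.+ s × n ≡ d ℕ.* (d ℕ.+ s))
difference-of-squares {n} {t} {s} s<t t²≡s²+4n = d , 0<d , t≡2d+s , n≡d[d+s]
  where
  a : ℕ
  a = t ∸ s
  a[2s+a]≡4n : a ℕ.* (2 ℕ.* s ℕ.+ a) ≡ 4 ℕ.* n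
  a[2s+a]≡4n = gap-product {n} (ℕₚ.<⇒≤ s<t) t²≡s²+4n
  open ℕᵈ._∣_ (even-gap {n} {s} a a[2s+a]≡4n) renaming (quotient to d; equality to a≡d*2)
  0<d : 0 < d
  0<d = ℕₚ.n≢0⇒n>0 λ d≡0 → ℕₚ.<⇒≢ (ℕₚ.m<n⇒0<n∸m s<t) (sym (trans a≡d*2 (cong (ℕ._* 2) d≡0)))
  rearrange : ∀ s d → s ℕ.+ d ℕ.* 2 ≡ 2 ℕ.* d ℕ.+ s
  rearrange = solve-∀
  t≡2d+s : t ≡ 2 ℕ.* d ℕ.+ s
  t≡2d+s = trans (sym (ℕₚ.m+[n∸m]≡n (ℕₚ.<⇒≤ s<t))) (trans (cong (s ℕ.+_) a≡d*2) (rearrange s d))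
  expand : ∀ d s → d ℕ.* 2 ℕ.* (2 ℕ.* s ℕ.+ d ℕ.* 2) ≡ 4 ℕ.* (d ℕ.* (d ℕ.+ s))
  expand = solve-∀
  n≡d[d+s] : n ≡ d ℕ.* (d ℕ.+ s)
  n≡d[d+s] = ℕₚ.*-cancelˡ-≡ n (d ℕ.* (d ℕ.+ s)) 4 (begin
    4 ℕ.* n                                ≡⟨ a[2s+a]≡4n ⟨
    a ℕ.* (2 ℕ.* s ℕ.+ a)                  ≡⟨ cong (λ x → x ℕ.* (2 ℕ.* s ℕ.+ x)) a≡d*2 ⟩
    d ℕ.* 2 ℕ.* (2 ℕ.* s ℕ.+ d ℕ.* 2)      ≡⟨ expand d s ⟩
    4 ℕ.* (d ℕ.* (d ℕ.+ s))                ∎)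

-- n = d e with e = d + s, whose point on t² = s² + 4n is t = d + e = 2d + s.
module Factorisation {n d s : ℕ} (0<d : 0 < d) (n≡d[d+s] : n ≡ d ℕ.* (d ℕ.+ s)) where

  cofactor : n ÷ d ≡ d ℕ.+ s
  cofactor = trans (cong (_÷ d) (trans n≡d[d+s] (ℕₚ.*-comm d (d ℕ.+ s)))) (*-÷-cancelʳ (d ℕ.+ s) 0<d)

  2d+s≡d+[d+s] : 2 ℕ.* d ℕ.+ s ≡ d ℕ.+ (d ℕ.+ s)
  2d+s≡d+[d+s] = shuffle d s
    where
    shuffle : ∀ d s → 2 ℕ.* d ℕ.+ s ≡ d ℕ.+ (d ℕ.+ s)
    shuffle = solve-∀

  sum : d ℕ.+ n ÷ d ≡ 2 ℕ.* d ℕ.+ s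
  sum = trans (cong (d ℕ.+_) cofactor) (sym 2d+s≡d+[d+s])

  difference : n ÷ d ∸ d ≡ s
  difference = trans (cong (_∸ d) cofactor) (ℕₚ.m+n∸m≡n d s)

  half-difference : (2 ℕ.* d ℕ.+ s ∸ s) / 2 ≡ d
  half-difference = trans (cong (_/ 2) (trans (ℕₚ.m+n∸n≡m (2 ℕ.* d) s) (ℕₚ.*-comm 2 d))) (m*n/n≡m d 2)

  on-hyperbola : (2 ℕ.* d ℕ.+ s) ℕ.* (2 ℕ.* d ℕ.+ s) ≡ s ℕ.* s ℕ.+ 4 ℕ.* n
  on-hyperbola = trans (expand d s) (cong (λ x → s ℕ.* s ℕ.+ 4 ℕ.* x) (sym n≡d[d+s]))
    where
    expand : ∀ d s → (2 ℕ.* d ℕ.+ s) ℕ.* (2 ℕ.* d ℕ.+ s) ≡ s ℕ.* s ℕ.+ 4 ℕ.* (d ℕ.* (d ℕ.+ s))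
    expand = solve-∀

  divides-n : d ∣ n
  divides-n = divides (d ℕ.+ s) (trans n≡d[d+s] (ℕₚ.*-comm d (d ℕ.+ s)))

  square-≤ : d ℕ.* d ≤ n
  square-≤ = subst (d ℕ.* d ≤_) (sym n≡d[d+s]) (ℕₚ.*-monoʳ-≤ d (ℕₚ.m≤m+n d s))

  ≤-n : d ≤ n
  ≤-n = ℕₚ.≤-trans (ℕₚ.m≤m*n d d {{ℕ.>-nonZero 0<d}}) square-≤

  cofactor-≤-n : d ℕ.+ s ≤ n
  cofactor-≤-n = subst (d ℕ.+ s ≤_) (sym n≡d[d+s]) (ℕₚ.m≤n*m (d ℕ.+ s) d {{ℕ.>-nonZero 0<d}})

  sum-≤ : 2 ℕ.* d ℕ.+ s ≤ 4 ℕ.* n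
  sum-≤ = ℕₚ.≤-trans (ℕₚ.≤-reflexive 2d+s≡d+[d+s])
            (ℕₚ.≤-trans (ℕₚ.+-mono-≤ ≤-n cofactor-≤-n)
                        (ℕₚ.≤-trans (ℕₚ.m≤m+n (n ℕ.+ n) (n ℕ.+ n)) (ℕₚ.≤-reflexive (double-double n))))
    where
    double-double : ∀ n → n ℕ.+ n ℕ.+ (n ℕ.+ n) ≡ 4 ℕ.* n
    double-double = solve-∀

  difference-≤ : s ≤ 4 ℕ.* n
  difference-≤ = ℕₚ.≤-trans (ℕₚ.m≤n+m s (2 ℕ.* d)) sum-≤

  difference-< : s < 2 ℕ.* d ℕ.+ s
  difference-< = ℕₚ.m<n+m s (ℕₚ.*-monoʳ-< 2 0<d)

  square-≡⇔ : d ℕ.* d ≡ n ⇔ s ≡ 0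
  square-≡⇔ = mk⇔
    (λ d²≡n → ℕₚ.+-cancelˡ-≡ d s 0 (trans (ℕₚ.*-cancelˡ-≡ (d ℕ.+ s) d d {{ℕ.>-nonZero 0<d}} (sym (trans d²≡n n≡d[d+s])))
                                           (sym (ℕₚ.+-identityʳ d))))
    (λ { refl → trans (cong (d ℕ.*_) (sym (ℕₚ.+-identityʳ d))) (sym n≡d[d+s]) })

divisor-gap : ∀ {n d} → 0 < d → d ∣ n → d ℕ.* d ≤ n → n ≡ d ℕ.* (d ℕ.+ (n ÷ d ∸ d))
divisor-gap {n} {d} 0<d d∣n d²≤n = trans n≡d*e (cong (d ℕ.*_) (sym (ℕₚ.m+[n∸m]≡n d≤e)))
  where
  n≡d*e : n ≡ d ℕ.* (n ÷ d)
  n≡d*e = ∣⇒≡*÷ 0<d d∣n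
  d≤e : d ≤ n ÷ d
  d≤e = ℕₚ.*-cancelˡ-≤ d {{ℕ.>-nonZero 0<d}} (subst (d ℕ.* d ≤_) n≡d*e d²≤n)

-- The weight ½ of the terms with s = 0 in λ, seen on the divisor side where s = 0 means d² = n.
weight : ℕ → ℕ → ℚ
weight n d = if ⌊ d ℕ.* d ≟ n ⌋ then ½ else 1ℚ

belowRoot : ℕ → ℕ → Bool
belowRoot n d = ⌊ 0 <? d ⌋ ∧ ⌊ d ∣? n ⌋ ∧ ⌊ d ℕ.* d ≤? n ⌋

belowRoot-true : ∀ {n d} → 0 < d → d ∣ n → d ℕ.* d ≤ n → belowRoot n d ≡ true
belowRoot-true {n} {d} 0<d d∣n d²≤n =
  cong₂ _∧_ (⌊⌋-true (0 <? d) 0<d) (cong₂ _∧_ (⌊⌋-true (d ∣? n) d∣n) (⌊⌋-true (d ℕ.* d ≤? n) d²≤n))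

belowRoot-sound : ∀ {n d} → belowRoot n d ≡ true → 0 < d × d ∣ n × d ℕ.* d ≤ n
belowRoot-sound {n} {d} holds =
  let (0<d , rest) = ∧-true ⌊ 0 <? d ⌋ holds
      (d∣n , d²≤n) = ∧-true ⌊ d ∣? n ⌋ rest
  in ⌊⌋-sound (0 <? d) 0<d , ⌊⌋-sound (d ∣? n) d∣n , ⌊⌋-sound (d ℕ.* d ≤? n) d²≤n

module _ (ℓ n : ℕ) where

  private
    hyperbola : (ℕ → Bool) → ℕ → ℕ → Bool
    hyperbola c t s = ⌊ s <? t ⌋ ∧ ⌊ t ℕ.* t ≟ s ℕ.* s ℕ.+ 4 ℕ.* n ⌋ ∧ c t

  ∑-difference-of-squares : (c : ℕ → Bool) →
    ∑[ t < suc (4 ℕ.* n) ] ∑[ s < suc (4 ℕ.* n) ]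
      ([ ⌊ s <? t ⌋ ∧ ⌊ t ℕ.* t ≟ s ℕ.* s ℕ.+ 4 ℕ.* n ⌋ ∧ c t ] ((if ⌊ s ≟ 0 ⌋ then ½ else 1ℚ) * ℕ→ℚ ((t ∸ s) ^ ℓ)))
    ≡ ∑[ d < suc n ] ([ belowRoot n d ∧ c (d ℕ.+ n ÷ d) ] (weight n d * ℕ→ℚ ((2 ℕ.* d) ^ ℓ)))
  ∑-difference-of-squares c =
    ∑-reindex₂ (suc (4 ℕ.* n)) (suc n) (hyperbola c) (λ t s → (if ⌊ s ≟ 0 ⌋ then ½ else 1ℚ) * ℕ→ℚ ((t ∸ s) ^ ℓ))
               (λ d → belowRoot n d ∧ c (d ℕ.+ n ÷ d)) (λ d → weight n d * ℕ→ℚ ((2 ℕ.* d) ^ ℓ))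
               (λ t s → (t ∸ s) / 2) (λ d → d ℕ.+ n ÷ d) (λ d → n ÷ d ∸ d) to from
    where
    to : ∀ t s → t < suc (4 ℕ.* n) → s < suc (4 ℕ.* n) → hyperbola c t s ≡ true →
         ∃[ d ] (d < suc n × (t ∸ s) / 2 ≡ d × d ℕ.+ n ÷ d ≡ t × n ÷ d ∸ d ≡ s × belowRoot n d ∧ c (d ℕ.+ n ÷ d) ≡ true
                 × weight n d * ℕ→ℚ ((2 ℕ.* d) ^ ℓ) ≡ (if ⌊ s ≟ 0 ⌋ then ½ else 1ℚ) * ℕ→ℚ ((t ∸ s) ^ ℓ))
    to t s _ _ holds =
      let (s<t , on-curve) = ∧-true ⌊ s <? t ⌋ holds
          (t²≡s²+4n , ct) = ∧-true ⌊ t ℕ.* t ≟ s ℕ.* s ℕ.+ 4 ℕ.* n ⌋ on-curve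
          (d , 0<d , t≡2d+s , n≡) = difference-of-squares (⌊⌋-sound (s <? t) s<t) (⌊⌋-sound (t ℕ.* t ≟ _) t²≡s²+4n)
          open Factorisation 0<d n≡
          t∸s≡2d = trans (cong (_∸ s) t≡2d+s) (ℕₚ.m+n∸n≡m (2 ℕ.* d) s)
          sum≡t = trans sum (sym t≡2d+s)
      in d , s≤s ≤-n , trans (cong (λ t → (t ∸ s) / 2) t≡2d+s) half-difference , sum≡t , difference ,
         cong₂ _∧_ (belowRoot-true 0<d divides-n square-≤) (trans (cong c sum≡t) ct) ,
         cong₂ (λ b x → (if b then ½ else 1ℚ) * ℕ→ℚ (x ^ ℓ)) (⌊⌋-⇔ square-≡⇔ (d ℕ.* d ≟ n) (s ≟ 0)) (sym t∸s≡2d)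
    from : ∀ d → d < suc n → belowRoot n d ∧ c (d ℕ.+ n ÷ d) ≡ true →
           d ℕ.+ n ÷ d < suc (4 ℕ.* n) × n ÷ d ∸ d < suc (4 ℕ.* n)
           × (d ℕ.+ n ÷ d ∸ (n ÷ d ∸ d)) / 2 ≡ d × hyperbola c (d ℕ.+ n ÷ d) (n ÷ d ∸ d) ≡ true
    from d _ holds =
      let (br , cφ) = ∧-true (belowRoot n d) holds
          (0<d , d∣n , d²≤n) = belowRoot-sound br
          open Factorisation {n} {d} {n ÷ d ∸ d} 0<d (divisor-gap 0<d d∣n d²≤n)
      in subst (_< suc (4 ℕ.* n)) (sym sum) (s≤s sum-≤) , s≤s difference-≤ ,
         trans (cong (λ t → (t ∸ (n ÷ d ∸ d)) / 2) sum) half-difference ,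
         subst (λ t → hyperbola c t (n ÷ d ∸ d) ≡ true) (sym sum)
           (cong₂ _∧_ (⌊⌋-true (_ <? _) difference-<)
                      (cong₂ _∧_ (⌊⌋-true (_ ≟ _) on-hyperbola) (trans (cong c (sym sum)) cφ)))

congB-cong : ∀ {M} t t′ m m′ → + M ℤᵈ.∣ + t - + t′ → + M ℤᵈ.∣ m - m′ → congB t m M ≡ congB t′ m′ M
congB-cong {M} t t′ m m′ t≡t′ m≡m′ = ⌊⌋-⇔
  (mk⇔ (λ M∣t-m → ∣⇒∣ᵤ (∣m+n∣n⇒∣m {m = + t′ - m′} (subst (+ M ℤᵈ.∣_) shift (∣ᵤ⇒∣ {i = + t - m} M∣t-m)) (∣m∣n⇒∣m-n t≡t′ m≡m′)))
       (λ M∣t′-m′ → ∣⇒∣ᵤ (subst (+ M ℤᵈ.∣_) (sym shift) (∣m∣n⇒∣m+n (∣ᵤ⇒∣ {i = + t′ - m′} M∣t′-m′) (∣m∣n⇒∣m-n t≡t′ m≡m′)))))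
  (M ∣? ℤ.∣ + t - m ∣) (M ∣? ℤ.∣ + t′ - m′ ∣)
  where
  regroup : ∀ t t′ m m′ → t - m ≡ (t′ - m′) ℤ.+ ((t - t′) - (m - m′))
  regroup = ℤ-Solver.solve-∀
  shift : + t - m ≡ (+ t′ - m′) ℤ.+ ((+ t - + t′) - (m - m′))
  shift = regroup (+ t) (+ t′) m m′

x%M≡y%M⇒M∣x-y : ∀ {M} .{{_ : NonZero M}} x y → x % M ≡ y % M → + M ℤᵈ.∣ + x - + y
x%M≡y%M⇒M∣x-y {M} x y x≡y = ℤᵈ.divides (+ (x / M) - + (y / M)) (begin
  + x - + y
    ≡⟨ cong₂ _-_ (split x) (split y) ⟩
  (+ (x % M) ℤ.+ + (x / M) ℤ.* + M) - (+ (y % M) ℤ.+ + (y / M) ℤ.* + M)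
    ≡⟨ cong (λ r → (+ r ℤ.+ + (x / M) ℤ.* + M) - (+ (y % M) ℤ.+ + (y / M) ℤ.* + M)) x≡y ⟩
  (+ (y % M) ℤ.+ + (x / M) ℤ.* + M) - (+ (y % M) ℤ.+ + (y / M) ℤ.* + M)
    ≡⟨ cancel (+ (y % M)) (+ (x / M)) (+ (y / M)) (+ M) ⟩
  (+ (x / M) - + (y / M)) ℤ.* + M ∎)
  where
  split : ∀ z → + z ≡ + (z % M) ℤ.+ + (z / M) ℤ.* + M
  split z = trans (cong +_ (m≡m%n+[m/n]*n z M)) (trans (ℤₚ.pos-+ (z % M) _) (cong (λ k → + (z % M) ℤ.+ k) (ℤₚ.pos-* (z / M) M)))
  cancel : ∀ r a b M → (r ℤ.+ a ℤ.* M) - (r ℤ.+ b ℤ.* M) ≡ (a - b) ℤ.* M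
  cancel = ℤ-Solver.solve-∀

M∣m-m%ℕM : ∀ m M .{{_ : NonZero M}} → + M ℤᵈ.∣ m - + (m %ℕ M)
M∣m-m%ℕM m M = ℤᵈ.divides (m /ℕ M) (trans (cong (_- + (m %ℕ M)) (a≡a%ℕn+[a/ℕn]*n m M)) (cancel (+ (m %ℕ M)) (m /ℕ M) (+ M)))
  where
  cancel : ∀ r q M → (r ℤ.+ q ℤ.* M) - r ≡ q ℤ.* M
  cancel = ℤ-Solver.solve-∀

M∣x-x : ∀ M x → + M ℤᵈ.∣ x - x
M∣x-x M x = ℤᵈ.divides (+ 0) (trans (ℤₚ.+-inverseʳ x) (sym (ℤₚ.*-zeroˡ (+ M))))

signCount : ℕ → ℤ → ℕ → ℚ
signCount t m M = 𝟙 (congB t m M) + 𝟙 (congB t (ℤ.- m) M)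

signCount-cong : ∀ {M} t t′ m m′ → + M ℤᵈ.∣ + t - + t′ → + M ℤᵈ.∣ m - m′ → signCount t m M ≡ signCount t′ m′ M
signCount-cong {M} t t′ m m′ t≡t′ m≡m′ =
  cong₂ (λ b c → 𝟙 b + 𝟙 c) (congB-cong t t′ m m′ t≡t′ m≡m′)
                            (congB-cong t t′ (ℤ.- m) (ℤ.- m′) t≡t′ (subst (+ M ℤᵈ.∣_) (negate m m′) (∣m⇒∣-m m≡m′)))
  where
  negate : ∀ m m′ → ℤ.- (m - m′) ≡ ℤ.- m - ℤ.- m′
  negate = ℤ-Solver.solve-∀

gcd-% : ∀ x M .{{_ : NonZero M}} → gcd x M ≡ gcd (x % M) M
gcd-% x M = ∣-antisym
  (gcd-greatest (%-presˡ-∣ (gcd[m,n]∣m x M) (gcd[m,n]∣n x M)) (gcd[m,n]∣n x M))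
  (gcd-greatest (∣n∣m%n⇒∣m (gcd[m,n]∣n (x % M) M) (gcd[m,n]∣m (x % M) M)) (gcd[m,n]∣n (x % M) M))

χ₆₀-cong : ∀ x y → x % 6 ≡ y % 6 → χ₆₀ x ≡ χ₆₀ y
χ₆₀-cong x y x≡y = cong (λ g → 𝟙 ⌊ g ≟ 1 ⌋) (trans (gcd-% x 6) (trans (cong (λ r → gcd r 6) x≡y) (sym (gcd-% y 6))))

ℕ→ℚ-* : ∀ a b → ℕ→ℚ (a ℕ.* b) ≡ ℕ→ℚ a * ℕ→ℚ b
ℕ→ℚ-* a b = begin
  ℕ→ℚ (a ℕ.* b)          ≡⟨ cong (ℚ._/ 1) (ℤₚ.pos-* a b) ⟩
  (+ a ℤ.* + b) ℚ./ 1    ≡⟨ cong₂ _*_ (as-mkℚ a) (as-mkℚ b) ⟨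
  ℕ→ℚ a * ℕ→ℚ b          ∎
  where
  as-mkℚ : ∀ a → ℕ→ℚ a ≡ mkℚ (+ a) 0 (coprime-sym (1-coprimeTo a))
  as-mkℚ a = ℚₚ.normalize-coprime (coprime-sym (1-coprimeTo a))

^-distribʳ-* : ∀ a b k → (a ℕ.* b) ^ k ≡ a ^ k ℕ.* b ^ k
^-distribʳ-* a b zero    = refl
^-distribʳ-* a b (suc k) = trans (cong (a ℕ.* b ℕ.*_) (^-distribʳ-* a b k)) (interchange a b (a ^ k) (b ^ k))
  where
  interchange : ∀ a b x y → a ℕ.* b ℕ.* (x ℕ.* y) ≡ a ℕ.* x ℕ.* (b ℕ.* y)
  interchange = solve-∀

ℕ→ℚ-[2*]^ : ∀ d ℓ → ℕ→ℚ ((2 ℕ.* d) ^ ℓ) ≡ 2^ ℓ * ℕ→ℚ (d ^ ℓ)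
ℕ→ℚ-[2*]^ d ℓ = trans (cong ℕ→ℚ (^-distribʳ-* 2 d ℓ)) (ℕ→ℚ-* (2 ^ ℓ) (d ^ ℓ))

2^-suc : ∀ ℓ → 2^ (suc ℓ) ≡ ℕ→ℚ 2 * 2^ ℓ
2^-suc ℓ = ℕ→ℚ-* 2 (2 ^ ℓ)

[]-signCount : ∀ c t m M v → ([ c ∧ congB t m M ] v) + ([ c ∧ congB t (ℤ.- m) M ] v) ≡ [ c ] (signCount t m M * v)
[]-signCount false t m M v = refl
[]-signCount true  t m M v = begin
  ([ congB t m M ] v) + ([ congB t (ℤ.- m) M ] v)   ≡⟨ cong₂ _+_ ([]≡𝟙* (congB t m M) v) ([]≡𝟙* (congB t (ℤ.- m) M) v) ⟩
  𝟙 (congB t m M) * v + 𝟙 (congB t (ℤ.- m) M) * v  ≡⟨ ℚₚ.*-distribʳ-+ v (𝟙 (congB t m M)) (𝟙 (congB t (ℤ.- m) M)) ⟨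
  signCount t m M * v                              ∎

∑-signCount : ∀ k (c : ℕ → Bool) (h : ℕ → ℕ) m M (v : ℕ → ℚ) →
  ∑[ x < k ] ([ c x ∧ congB (h x) m M ] v x) + ∑[ x < k ] ([ c x ∧ congB (h x) (ℤ.- m) M ] v x)
  ≡ ∑[ x < k ] ([ c x ] (signCount (h x) m M * v x))
∑-signCount k c h m M v = trans (sym (∑-+ k _ _)) (∑-cong k λ x _ → []-signCount (c x) (h x) m M (v x))

module _ (ℓ n : ℕ) where

  lamTerm : ℤ → ℕ → ℚ
  lamTerm m d = [ belowRoot n d ] (signCount (d ℕ.+ n ÷ d) m 6 * (weight n d * ℕ→ℚ ((2 ℕ.* d) ^ ℓ)))

  gTerm : ℕ → ℚ
  gTerm d = [ ⌊ 0 <? d ⌋ ∧ ⌊ d ∣? n ⌋ ∧ ⌊ d ℕ.* d <? n ⌋ ] (signCount d (+ 1) 3 * ℕ→ℚ (d ^ ℓ))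

  tTerm : ℕ → ℚ
  tTerm d = [ ⌊ 0 <? d ⌋ ∧ ⌊ d ℕ.* d ≟ n ⌋ ] (signCount d (+ 1) 6 * ℕ→ℚ (d ^ ℓ))

  lamCoeff-∑ : ∀ m → lamCoeff ℓ m 6 (4 ℕ.* n) ≡ ∑< (suc n) (lamTerm m)
  lamCoeff-∑ m = trans (cong₂ _+_ (∑-difference-of-squares ℓ n (λ t → congB t m 6))
                                  (∑-difference-of-squares ℓ n (λ t → congB t (ℤ.- m) 6)))
                       (∑-signCount (suc n) (belowRoot n) (λ d → d ℕ.+ n ÷ d) m 6 _)

  gCoeff-∑ : gCoeff ℓ (+ 1) 3 n ≡ ∑< (suc n) gTerm
  gCoeff-∑ = trans (cong₂ _+_ (∑-cong (suc n) λ d _ → cong ([_] _) (reassoc d _)) (∑-cong (suc n) λ d _ → cong ([_] _) (reassoc d _)))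
                   (∑-signCount (suc n) (λ d → ⌊ 0 <? d ⌋ ∧ ⌊ d ∣? n ⌋ ∧ ⌊ d ℕ.* d <? n ⌋) (λ d → d) (+ 1) 3 _)
    where
    reassoc : ∀ d x → ⌊ 0 <? d ⌋ ∧ ⌊ d ∣? n ⌋ ∧ ⌊ d ℕ.* d <? n ⌋ ∧ x ≡ (⌊ 0 <? d ⌋ ∧ ⌊ d ∣? n ⌋ ∧ ⌊ d ℕ.* d <? n ⌋) ∧ x
    reassoc d x = sym (trans (∧-assoc ⌊ 0 <? d ⌋ _ x) (cong (⌊ 0 <? d ⌋ ∧_) (∧-assoc ⌊ d ∣? n ⌋ _ x)))

  tCoeff-∑ : tCoeff ℓ (+ 1) 6 n ≡ ∑< (suc n) tTerm
  tCoeff-∑ = trans (cong₂ _+_ (∑-cong (suc n) λ d _ → cong ([_] _) (reassoc d _)) (∑-cong (suc n) λ d _ → cong ([_] _) (reassoc d _)))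
                   (∑-signCount (suc n) (λ d → ⌊ 0 <? d ⌋ ∧ ⌊ d ℕ.* d ≟ n ⌋) (λ d → d) (+ 1) 6 _)
    where
    reassoc : ∀ d x → ⌊ 0 <? d ⌋ ∧ ⌊ d ℕ.* d ≟ n ⌋ ∧ x ≡ (⌊ 0 <? d ⌋ ∧ ⌊ d ℕ.* d ≟ n ⌋) ∧ x
    reassoc d x = sym (∧-assoc ⌊ 0 <? d ⌋ _ x)

data Regime (n d : ℕ) : Set where
  below : 0 < d → d ∣ n → d ℕ.* d < n → Regime n d
  root  : 0 < d → d ℕ.* d ≡ n → Regime n d
  off   : ¬ (0 < d × d ∣ n × d ℕ.* d ≤ n) → Regime n d

regime : ∀ n d → Regime n d
regime n d with 0 <? d | d ∣? n | ℕₚ.<-cmp (d ℕ.* d) n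
... | no ¬0<d | _       | _           = off λ (0<d , _) → ¬0<d 0<d
... | yes 0<d | _       | tri≈ _ eq _ = root 0<d eq
... | yes 0<d | no ¬d∣n | _           = off λ (_ , d∣n , _) → ¬d∣n d∣n
... | yes 0<d | yes d∣n | tri< lt _ _ = below 0<d d∣n lt
... | yes 0<d | yes d∣n | tri> _ _ gt = off λ (_ , _ , le) → ℕₚ.<⇒≱ gt le

χ₆₀-*% : ∀ {n} d e → n ≡ d ℕ.* e → χ₆₀ n ≡ χ₆₀ (d % 6 ℕ.* (e % 6))
χ₆₀-*% d e refl = χ₆₀-cong (d ℕ.* e) (d % 6 ℕ.* (e % 6)) (%-distribˡ-* d e 6)

congB-*% : ∀ {n} d e ρ → n ≡ d ℕ.* e → congB n (+ ρ) 6 ≡ congB (d % 6 ℕ.* (e % 6)) (+ ρ) 6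
congB-*% d e ρ refl = congB-cong (d ℕ.* e) (d % 6 ℕ.* (e % 6)) (+ ρ) (+ ρ) (x%M≡y%M⇒M∣x-y (d ℕ.* e) (d % 6 ℕ.* (e % 6)) (%-distribˡ-* d e 6)) (M∣x-x 6 (+ ρ))

signCount-+% : ∀ d e m → signCount (d ℕ.+ e) m 6 ≡ signCount (d % 6 ℕ.+ e % 6) (+ (m %ℕ 6)) 6
signCount-+% d e m = signCount-cong (d ℕ.+ e) (d % 6 ℕ.+ e % 6) m (+ (m %ℕ 6)) (x%M≡y%M⇒M∣x-y (d ℕ.+ e) (d % 6 ℕ.+ e % 6) (%-distribˡ-+ d e 6)) (M∣m-m%ℕM m 6)

signCount-% : ∀ d M .{{_ : NonZero M}} → M ∣ 6 → signCount d (+ 1) M ≡ signCount (d % 6) (+ 1) M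
signCount-% d M M∣6 = signCount-cong d (d % 6) (+ 1) (+ 1) (x%M≡y%M⇒M∣x-y d (d % 6) (sym (m∣n⇒o%n%m≡o%m M 6 d M∣6))) (M∣x-x M (+ 1))

weight-below : ∀ {n} d → d ℕ.* d < n → weight n d ≡ 1ℚ
weight-below {n} d d²<n = cong (if_then ½ else 1ℚ) (⌊⌋-false (d ℕ.* d ≟ n) (ℕₚ.<⇒≢ d²<n))

weight-root : ∀ {n} d → d ℕ.* d ≡ n → weight n d ≡ ½
weight-root {n} d d²≡n = cong (if_then ½ else 1ℚ) (⌊⌋-true (d ℕ.* d ≟ n) d²≡n)

module _ (ℓ n : ℕ) where

  lamTerm-below : ∀ {d} m → 0 < d → d ∣ n → d ℕ.* d < n → χ₆₀ n * lamTerm ℓ n m d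
    ≡ (χ₆₀ (d % 6 ℕ.* (n ÷ d % 6)) * signCount (d % 6 ℕ.+ n ÷ d % 6) (+ (m %ℕ 6)) 6) * (2^ ℓ * ℕ→ℚ (d ^ ℓ))
  lamTerm-below {d} m 0<d d∣n d²<n = begin
    χ₆₀ n * lamTerm ℓ n m d
      ≡⟨ cong (λ b → χ₆₀ n * ([ b ] (c * (w * P)))) (belowRoot-true 0<d d∣n (ℕₚ.<⇒≤ d²<n)) ⟩
    χ₆₀ n * (c * (w * P))
      ≡⟨ cong₂ (λ χ c → χ * (c * (w * P))) (χ₆₀-*% d (n ÷ d) (∣⇒≡*÷ 0<d d∣n)) (signCount-+% d (n ÷ d) m) ⟩
    χ′ * (c′ * (w * P))
      ≡⟨ cong₂ (λ w P → χ′ * (c′ * (w * P))) (weight-below d d²<n) (ℕ→ℚ-[2*]^ d ℓ) ⟩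
    χ′ * (c′ * (1ℚ * (2^ ℓ * D)))
      ≡⟨ solve 4 (λ χ c P D → χ :* (c :* (con 1ℚ :* (P :* D))) := (χ :* c) :* (P :* D)) refl χ′ c′ (2^ ℓ) D ⟩
    (χ′ * c′) * (2^ ℓ * D) ∎
    where
    c w P D χ′ c′ : ℚ
    c  = signCount (d ℕ.+ n ÷ d) m 6
    w  = weight n d
    P  = ℕ→ℚ ((2 ℕ.* d) ^ ℓ)
    D  = ℕ→ℚ (d ^ ℓ)
    χ′ = χ₆₀ (d % 6 ℕ.* (n ÷ d % 6))
    c′ = signCount (d % 6 ℕ.+ n ÷ d % 6) (+ (m %ℕ 6)) 6

  gTerm-below : ∀ {d} ρ → 0 < d → d ∣ n → d ℕ.* d < n → 𝟙 (congB n (+ ρ) 6) * gTerm ℓ n d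
    ≡ (𝟙 (congB (d % 6 ℕ.* (n ÷ d % 6)) (+ ρ) 6) * signCount (d % 6) (+ 1) 3) * ℕ→ℚ (d ^ ℓ)
  gTerm-below {d} ρ 0<d d∣n d²<n = begin
    𝟙 (congB n (+ ρ) 6) * gTerm ℓ n d       ≡⟨ cong (λ b → 𝟙 (congB n (+ ρ) 6) * ([ b ] (c * D))) support ⟩
    𝟙 (congB n (+ ρ) 6) * (c * D)           ≡⟨ cong₂ (λ b c → 𝟙 b * (c * D)) (congB-*% d (n ÷ d) ρ (∣⇒≡*÷ 0<d d∣n))
                                                                         (signCount-% d 3 (divides 2 refl)) ⟩
    𝟙 b′ * (c′ * D)                         ≡⟨ ℚₚ.*-assoc (𝟙 b′) c′ D ⟨
    (𝟙 b′ * c′) * D                         ∎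
    where
    c D c′ : ℚ
    c  = signCount d (+ 1) 3
    D  = ℕ→ℚ (d ^ ℓ)
    c′ = signCount (d % 6) (+ 1) 3
    b′ : Bool
    b′ = congB (d % 6 ℕ.* (n ÷ d % 6)) (+ ρ) 6
    support : ⌊ 0 <? d ⌋ ∧ ⌊ d ∣? n ⌋ ∧ ⌊ d ℕ.* d <? n ⌋ ≡ true
    support = cong₂ _∧_ (⌊⌋-true (0 <? d) 0<d) (cong₂ _∧_ (⌊⌋-true (d ∣? n) d∣n) (⌊⌋-true (d ℕ.* d <? n) d²<n))

  tTerm-below : ∀ {d} → d ℕ.* d < n → tTerm ℓ n d ≡ 0ℚ
  tTerm-below {d} d²<n = []-off _ λ holds → ℕₚ.<⇒≢ d²<n (⌊⌋-sound (d ℕ.* d ≟ n) (proj₂ (∧-true ⌊ 0 <? d ⌋ holds)))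

  lamTerm-root : ∀ {d} m → 0 < d → d ℕ.* d ≡ n → χ₆₀ n * lamTerm ℓ n m d
    ≡ (χ₆₀ (d % 6 ℕ.* (d % 6)) * signCount (d % 6 ℕ.+ d % 6) (+ (m %ℕ 6)) 6) * (½ * (2^ ℓ * ℕ→ℚ (d ^ ℓ)))
  lamTerm-root {d} m 0<d d²≡n = begin
    χ₆₀ n * lamTerm ℓ n m d
      ≡⟨ cong (λ b → χ₆₀ n * ([ b ] (c * (w * P)))) (belowRoot-true 0<d (divides d (sym d²≡n)) (ℕₚ.≤-reflexive d²≡n)) ⟩
    χ₆₀ n * (c * (w * P))
      ≡⟨ cong₂ (λ χ c → χ * (c * (w * P))) (χ₆₀-*% d d (sym d²≡n))
               (trans (cong (λ e → signCount (d ℕ.+ e) m 6) n÷d≡d) (signCount-+% d d m)) ⟩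
    χ′ * (c′ * (w * P))
      ≡⟨ cong₂ (λ w P → χ′ * (c′ * (w * P))) (weight-root d d²≡n) (ℕ→ℚ-[2*]^ d ℓ) ⟩
    χ′ * (c′ * (½ * (2^ ℓ * D)))
      ≡⟨ ℚₚ.*-assoc χ′ c′ _ ⟨
    (χ′ * c′) * (½ * (2^ ℓ * D)) ∎
    where
    c w P D χ′ c′ : ℚ
    c  = signCount (d ℕ.+ n ÷ d) m 6
    w  = weight n d
    P  = ℕ→ℚ ((2 ℕ.* d) ^ ℓ)
    D  = ℕ→ℚ (d ^ ℓ)
    χ′ = χ₆₀ (d % 6 ℕ.* (d % 6))
    c′ = signCount (d % 6 ℕ.+ d % 6) (+ (m %ℕ 6)) 6
    n÷d≡d : n ÷ d ≡ d
    n÷d≡d = trans (cong (_÷ d) (sym d²≡n)) (*-÷-cancelʳ d 0<d)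

  gTerm-root : ∀ {d} → d ℕ.* d ≡ n → gTerm ℓ n d ≡ 0ℚ
  gTerm-root {d} d²≡n = []-off _ λ holds →
    let (_ , rest) = ∧-true ⌊ 0 <? d ⌋ holds in
    ℕₚ.<-irrefl d²≡n (⌊⌋-sound (d ℕ.* d <? n) (proj₂ (∧-true ⌊ d ∣? n ⌋ rest)))

  tTerm-root : ∀ {d} → 0 < d → d ℕ.* d ≡ n → tTerm ℓ n d ≡ signCount (d % 6) (+ 1) 6 * ℕ→ℚ (d ^ ℓ)
  tTerm-root {d} 0<d d²≡n =
    trans (cong (λ b → [ b ] (signCount d (+ 1) 6 * ℕ→ℚ (d ^ ℓ))) (cong₂ _∧_ (⌊⌋-true (0 <? d) 0<d) (⌊⌋-true (d ℕ.* d ≟ n) d²≡n)))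
          (cong (_* ℕ→ℚ (d ^ ℓ)) (signCount-% d 6 (divides 1 refl)))

  module _ {d} (off : ¬ (0 < d × d ∣ n × d ℕ.* d ≤ n)) where

    lamTerm-off : ∀ m → lamTerm ℓ n m d ≡ 0ℚ
    lamTerm-off m = []-off _ λ holds → off (belowRoot-sound holds)

    gTerm-off : gTerm ℓ n d ≡ 0ℚ
    gTerm-off = []-off _ λ holds →
      let (0<d , rest) = ∧-true ⌊ 0 <? d ⌋ holds
          (d∣n , d²<n) = ∧-true ⌊ d ∣? n ⌋ rest
      in off (⌊⌋-sound (0 <? d) 0<d , ⌊⌋-sound (d ∣? n) d∣n , ℕₚ.<⇒≤ (⌊⌋-sound (d ℕ.* d <? n) d²<n))

    tTerm-off : tTerm ℓ n d ≡ 0ℚ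
    tTerm-off = []-off _ λ holds →
      let (0<d , d²≡n) = ∧-true ⌊ 0 <? d ⌋ holds
          d²≡n = ⌊⌋-sound (d ℕ.* d ≟ n) d²≡n
      in off (⌊⌋-sound (0 <? d) 0<d , divides d (sym d²≡n) , ℕₚ.≤-reflexive d²≡n)

-- Sign counts on residues modulo 6, checked by evaluation

by-residue : ∀ {P : ℕ → Set} (P? : ∀ a → Dec (P a)) →
             {True (all? λ (i : Fin 6) → P? (toℕ i))} → ∀ a → a < 6 → P a
by-residue {P} P? {holds} a a<6 = subst P (toℕ-fromℕ< a<6) (toWitness holds (fromℕ< a<6))

by-residues : ∀ {P : ℕ → ℕ → Set} (P? : ∀ a b → Dec (P a b)) →
              {True (all? λ (i : Fin 6) → all? λ (j : Fin 6) → P? (toℕ i) (toℕ j))} →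
              ∀ a b → a < 6 → b < 6 → P a b
by-residues {P} P? {holds} a b a<6 b<6 =
  subst₂ P (toℕ-fromℕ< a<6) (toℕ-fromℕ< b<6) (toWitness holds (fromℕ< a<6) (fromℕ< b<6))

signs-m≡0 : ∀ {r} → r ≡ 0 → ∀ a b → a < 6 → b < 6 →
            χ₆₀ (a ℕ.* b) * signCount (a ℕ.+ b) (+ r) 6 ≡ ℕ→ℚ 2 * (𝟙 (congB (a ℕ.* b) (+ 5) 6) * signCount a (+ 1) 3)
signs-m≡0 refl = by-residues λ _ _ → _ ℚₚ.≟ _

signs-m≡0-square : ∀ {r} → r ≡ 0 → ∀ a → a < 6 → χ₆₀ (a ℕ.* a) * signCount (a ℕ.+ a) (+ r) 6 ≡ 0ℚ
signs-m≡0-square refl = by-residue λ _ → _ ℚₚ.≟ _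

signs-m-odd : ∀ {r} → r ≡ 1 ⊎ r ≡ 3 ⊎ r ≡ 5 → ∀ a b → a < 6 → b < 6 →
              χ₆₀ (a ℕ.* b) * signCount (a ℕ.+ b) (+ r) 6 ≡ 0ℚ
signs-m-odd (inj₁ refl)        = by-residues λ _ _ → _ ℚₚ.≟ _
signs-m-odd (inj₂ (inj₁ refl)) = by-residues λ _ _ → _ ℚₚ.≟ _
signs-m-odd (inj₂ (inj₂ refl)) = by-residues λ _ _ → _ ℚₚ.≟ _

signs-m≡±2 : ∀ {r} → r ≡ 2 ⊎ r ≡ 4 → ∀ a b → a < 6 → b < 6 →
             χ₆₀ (a ℕ.* b) * signCount (a ℕ.+ b) (+ r) 6 ≡ 𝟙 (congB (a ℕ.* b) (+ 1) 6) * signCount a (+ 1) 3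
signs-m≡±2 (inj₁ refl) = by-residues λ _ _ → _ ℚₚ.≟ _
signs-m≡±2 (inj₂ refl) = by-residues λ _ _ → _ ℚₚ.≟ _

signs-m≡±2-square : ∀ {r} → r ≡ 2 ⊎ r ≡ 4 → ∀ a → a < 6 →
                    χ₆₀ (a ℕ.* a) * signCount (a ℕ.+ a) (+ r) 6 ≡ signCount a (+ 1) 6
signs-m≡±2-square (inj₁ refl) = by-residue λ _ → _ ℚₚ.≟ _
signs-m≡±2-square (inj₂ refl) = by-residue λ _ → _ ℚₚ.≟ _

module _ (ℓ n : ℕ) (m : ℤ) where

  pointwise-m≡0 : m %ℕ 6 ≡ 0 → ∀ {d} → Regime n d →
    χ₆₀ n * lamTerm ℓ n m d ≡ 2^ (suc ℓ) * (𝟙 (congB n (+ 5) 6) * gTerm ℓ n d)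
  pointwise-m≡0 r≡0 {d} (below 0<d d∣n d²<n) = begin
    χ₆₀ n * lamTerm ℓ n m d
      ≡⟨ lamTerm-below ℓ n m 0<d d∣n d²<n ⟩
    (χ₆₀ (a ℕ.* b) * signCount (a ℕ.+ b) (+ (m %ℕ 6)) 6) * (2^ ℓ * D)
      ≡⟨ cong (_* (2^ ℓ * D)) (signs-m≡0 r≡0 a b (m%n<n d 6) (m%n<n (n ÷ d) 6)) ⟩
    (ℕ→ℚ 2 * X) * (2^ ℓ * D)
      ≡⟨ solve 4 (λ t X P D → (t :* X) :* (P :* D) := (t :* P) :* (X :* D)) refl (ℕ→ℚ 2) X (2^ ℓ) D ⟩
    (ℕ→ℚ 2 * 2^ ℓ) * (X * D)
      ≡⟨ cong₂ _*_ (2^-suc ℓ) (gTerm-below ℓ n 5 0<d d∣n d²<n) ⟨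
    2^ (suc ℓ) * (𝟙 (congB n (+ 5) 6) * gTerm ℓ n d) ∎
    where
    a b : ℕ
    a = d % 6
    b = n ÷ d % 6
    X D : ℚ
    X = 𝟙 (congB (a ℕ.* b) (+ 5) 6) * signCount a (+ 1) 3
    D = ℕ→ℚ (d ^ ℓ)
  pointwise-m≡0 r≡0 {d} (root 0<d d²≡n) = begin
    χ₆₀ n * lamTerm ℓ n m d
      ≡⟨ lamTerm-root ℓ n m 0<d d²≡n ⟩
    (χ₆₀ (a ℕ.* a) * signCount (a ℕ.+ a) (+ (m %ℕ 6)) 6) * K
      ≡⟨ cong (_* K) (signs-m≡0-square r≡0 a (m%n<n d 6)) ⟩
    0ℚ * K
      ≡⟨ solve 3 (λ K P i → con 0ℚ :* K := P :* (i :* con 0ℚ)) refl K (2^ (suc ℓ)) (𝟙 (congB n (+ 5) 6)) ⟩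
    2^ (suc ℓ) * (𝟙 (congB n (+ 5) 6) * 0ℚ)
      ≡⟨ cong (λ g → 2^ (suc ℓ) * (𝟙 (congB n (+ 5) 6) * g)) (gTerm-root ℓ n {d} d²≡n) ⟨
    2^ (suc ℓ) * (𝟙 (congB n (+ 5) 6) * gTerm ℓ n d) ∎
    where
    a : ℕ
    a = d % 6
    K : ℚ
    K = ½ * (2^ ℓ * ℕ→ℚ (d ^ ℓ))
  pointwise-m≡0 r≡0 {d} (off ¬divisor) = begin
    χ₆₀ n * lamTerm ℓ n m d
      ≡⟨ cong (χ₆₀ n *_) (lamTerm-off ℓ n ¬divisor m) ⟩
    χ₆₀ n * 0ℚ
      ≡⟨ solve 3 (λ χ P i → χ :* con 0ℚ := P :* (i :* con 0ℚ)) refl (χ₆₀ n) (2^ (suc ℓ)) (𝟙 (congB n (+ 5) 6)) ⟩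
    2^ (suc ℓ) * (𝟙 (congB n (+ 5) 6) * 0ℚ)
      ≡⟨ cong (λ g → 2^ (suc ℓ) * (𝟙 (congB n (+ 5) 6) * g)) (gTerm-off ℓ n ¬divisor) ⟨
    2^ (suc ℓ) * (𝟙 (congB n (+ 5) 6) * gTerm ℓ n d) ∎

  pointwise-m-odd : m %ℕ 6 ≡ 1 ⊎ m %ℕ 6 ≡ 3 ⊎ m %ℕ 6 ≡ 5 → ∀ {d} → Regime n d → χ₆₀ n * lamTerm ℓ n m d ≡ 0ℚ
  pointwise-m-odd r-odd {d} (below 0<d d∣n d²<n) = begin
    χ₆₀ n * lamTerm ℓ n m d
      ≡⟨ lamTerm-below ℓ n m 0<d d∣n d²<n ⟩
    (χ₆₀ (a ℕ.* b) * signCount (a ℕ.+ b) (+ (m %ℕ 6)) 6) * K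
      ≡⟨ cong (_* K) (signs-m-odd r-odd a b (m%n<n d 6) (m%n<n (n ÷ d) 6)) ⟩
    0ℚ * K
      ≡⟨ ℚₚ.*-zeroˡ K ⟩
    0ℚ ∎
    where
    a b : ℕ
    a = d % 6
    b = n ÷ d % 6
    K : ℚ
    K = 2^ ℓ * ℕ→ℚ (d ^ ℓ)
  pointwise-m-odd r-odd {d} (root 0<d d²≡n) = begin
    χ₆₀ n * lamTerm ℓ n m d
      ≡⟨ lamTerm-root ℓ n m 0<d d²≡n ⟩
    (χ₆₀ (a ℕ.* a) * signCount (a ℕ.+ a) (+ (m %ℕ 6)) 6) * K
      ≡⟨ cong (_* K) (signs-m-odd r-odd a a (m%n<n d 6) (m%n<n d 6)) ⟩
    0ℚ * K
      ≡⟨ ℚₚ.*-zeroˡ K ⟩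
    0ℚ ∎
    where
    a : ℕ
    a = d % 6
    K : ℚ
    K = ½ * (2^ ℓ * ℕ→ℚ (d ^ ℓ))
  pointwise-m-odd r-odd {d} (off ¬divisor) =
    trans (cong (χ₆₀ n *_) (lamTerm-off ℓ n ¬divisor m)) (ℚₚ.*-zeroʳ (χ₆₀ n))

  pointwise-m≡±2 : m %ℕ 6 ≡ 2 ⊎ m %ℕ 6 ≡ 4 → ∀ {d} → Regime n d →
    χ₆₀ n * lamTerm ℓ n m d ≡ 2^ ℓ * (𝟙 (congB n (+ 1) 6) * gTerm ℓ n d) + (2^ ℓ * ½) * tTerm ℓ n d
  pointwise-m≡±2 r≡±2 {d} (below 0<d d∣n d²<n) = begin
    χ₆₀ n * lamTerm ℓ n m d
      ≡⟨ lamTerm-below ℓ n m 0<d d∣n d²<n ⟩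
    (χ₆₀ (a ℕ.* b) * signCount (a ℕ.+ b) (+ (m %ℕ 6)) 6) * (2^ ℓ * D)
      ≡⟨ cong (_* (2^ ℓ * D)) (signs-m≡±2 r≡±2 a b (m%n<n d 6) (m%n<n (n ÷ d) 6)) ⟩
    X * (2^ ℓ * D)
      ≡⟨ solve 3 (λ X P D → X :* (P :* D) := P :* (X :* D) :+ (P :* con ½) :* con 0ℚ) refl X (2^ ℓ) D ⟩
    2^ ℓ * (X * D) + (2^ ℓ * ½) * 0ℚ
      ≡⟨ cong₂ (λ g t → 2^ ℓ * g + (2^ ℓ * ½) * t) (gTerm-below ℓ n 1 0<d d∣n d²<n) (tTerm-below ℓ n {d} d²<n) ⟨
    2^ ℓ * (𝟙 (congB n (+ 1) 6) * gTerm ℓ n d) + (2^ ℓ * ½) * tTerm ℓ n d ∎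
    where
    a b : ℕ
    a = d % 6
    b = n ÷ d % 6
    X D : ℚ
    X = 𝟙 (congB (a ℕ.* b) (+ 1) 6) * signCount a (+ 1) 3
    D = ℕ→ℚ (d ^ ℓ)
  pointwise-m≡±2 r≡±2 {d} (root 0<d d²≡n) = begin
    χ₆₀ n * lamTerm ℓ n m d
      ≡⟨ lamTerm-root ℓ n m 0<d d²≡n ⟩
    (χ₆₀ (a ℕ.* a) * signCount (a ℕ.+ a) (+ (m %ℕ 6)) 6) * (½ * (2^ ℓ * D))
      ≡⟨ cong (_* (½ * (2^ ℓ * D))) (signs-m≡±2-square r≡±2 a (m%n<n d 6)) ⟩
    c * (½ * (2^ ℓ * D))
      ≡⟨ solve 4 (λ i c P D → c :* (con ½ :* (P :* D)) := P :* (i :* con 0ℚ) :+ (P :* con ½) :* (c :* D)) refl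
                 (𝟙 (congB n (+ 1) 6)) c (2^ ℓ) D ⟩
    2^ ℓ * (𝟙 (congB n (+ 1) 6) * 0ℚ) + (2^ ℓ * ½) * (c * D)
      ≡⟨ cong₂ (λ g t → 2^ ℓ * (𝟙 (congB n (+ 1) 6) * g) + (2^ ℓ * ½) * t) (gTerm-root ℓ n {d} d²≡n) (tTerm-root ℓ n 0<d d²≡n) ⟨
    2^ ℓ * (𝟙 (congB n (+ 1) 6) * gTerm ℓ n d) + (2^ ℓ * ½) * tTerm ℓ n d ∎
    where
    a : ℕ
    a = d % 6
    c D : ℚ
    c = signCount a (+ 1) 6
    D = ℕ→ℚ (d ^ ℓ)
  pointwise-m≡±2 r≡±2 {d} (off ¬divisor) = begin
    χ₆₀ n * lamTerm ℓ n m d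
      ≡⟨ cong (χ₆₀ n *_) (lamTerm-off ℓ n ¬divisor m) ⟩
    χ₆₀ n * 0ℚ
      ≡⟨ solve 3 (λ χ P i → χ :* con 0ℚ := P :* (i :* con 0ℚ) :+ (P :* con ½) :* con 0ℚ) refl (χ₆₀ n) (2^ ℓ) (𝟙 (congB n (+ 1) 6)) ⟩
    2^ ℓ * (𝟙 (congB n (+ 1) 6) * 0ℚ) + (2^ ℓ * ½) * 0ℚ
      ≡⟨ cong₂ (λ g t → 2^ ℓ * (𝟙 (congB n (+ 1) 6) * g) + (2^ ℓ * ½) * t) (gTerm-off ℓ n ¬divisor) (tTerm-off ℓ n ¬divisor) ⟨
    2^ ℓ * (𝟙 (congB n (+ 1) 6) * gTerm ℓ n d) + (2^ ℓ * ½) * tTerm ℓ n d ∎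

  twisted-lamCoeff-∑ : χ₆₀ n * lamCoeff ℓ m 6 (4 ℕ.* n) ≡ ∑[ d < suc n ] (χ₆₀ n * lamTerm ℓ n m d)
  twisted-lamCoeff-∑ = trans (cong (χ₆₀ n *_) (lamCoeff-∑ ℓ n m)) (∑-*ˡ (suc n) (χ₆₀ n) (lamTerm ℓ n m))

  scaled-sieved-gCoeff-∑ : ∀ c b → c * ([ b ] gCoeff ℓ (+ 1) 3 n) ≡ ∑[ d < suc n ] (c * (𝟙 b * gTerm ℓ n d))
  scaled-sieved-gCoeff-∑ c b = begin
    c * ([ b ] gCoeff ℓ (+ 1) 3 n)                   ≡⟨ cong (c *_) ([]≡𝟙* b (gCoeff ℓ (+ 1) 3 n)) ⟩
    c * (𝟙 b * gCoeff ℓ (+ 1) 3 n)                   ≡⟨ cong (λ g → c * (𝟙 b * g)) (gCoeff-∑ ℓ n) ⟩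
    c * (𝟙 b * ∑< (suc n) (gTerm ℓ n))               ≡⟨ cong (c *_) (∑-*ˡ (suc n) (𝟙 b) (gTerm ℓ n)) ⟩
    c * ∑[ d < suc n ] (𝟙 b * gTerm ℓ n d)           ≡⟨ ∑-*ˡ (suc n) c _ ⟩
    ∑[ d < suc n ] (c * (𝟙 b * gTerm ℓ n d))         ∎

  scaled-tCoeff-∑ : ∀ c → c * tCoeff ℓ (+ 1) 6 n ≡ ∑[ d < suc n ] (c * tTerm ℓ n d)
  scaled-tCoeff-∑ c = trans (cong (c *_) (tCoeff-∑ ℓ n)) (∑-*ˡ (suc n) c (tTerm ℓ n))

lemma3p3 : (ℓ : ℕ) (m : ℤ) →
    ((m %ℕ 6 ≡ 0) →
      ∀ n → (Λ ℓ m 6 ∣U 4 ⊗ χ₆₀) n ≡ (2^ (suc ℓ) · S 6 (+ 5) (G ℓ (+ 1) 3)) n)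
    × ((m %ℕ 6 ≡ 1 ⊎ m %ℕ 6 ≡ 3 ⊎ m %ℕ 6 ≡ 5) →
      ∀ n → (Λ ℓ m 6 ∣U 4 ⊗ χ₆₀) n ≡ zeroS n)
    × ((m %ℕ 6 ≡ 2 ⊎ m %ℕ 6 ≡ 4) →
      ∀ n → (Λ ℓ m 6 ∣U 4 ⊗ χ₆₀) n
        ≡ (2^ ℓ · S 6 (+ 1) (G ℓ (+ 1) 3) ⊕ (2^ ℓ * ½) · T ℓ (+ 1) 6) n)
lemma3p3 ℓ m = case-A , case-B , case-C
  where
  case-A : m %ℕ 6 ≡ 0 → ∀ n → χ₆₀ n * lamCoeff ℓ m 6 (4 ℕ.* n) ≡ 2^ (suc ℓ) * ([ congB n (+ 5) 6 ] gCoeff ℓ (+ 1) 3 n)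
  case-A r≡0 n = begin
    χ₆₀ n * lamCoeff ℓ m 6 (4 ℕ.* n)                               ≡⟨ twisted-lamCoeff-∑ ℓ n m ⟩
    ∑[ d < suc n ] (χ₆₀ n * lamTerm ℓ n m d)                         ≡⟨ ∑-cong (suc n) (λ d _ → pointwise-m≡0 ℓ n m r≡0 (regime n d)) ⟩
    ∑[ d < suc n ] (2^ (suc ℓ) * (𝟙 (congB n (+ 5) 6) * gTerm ℓ n d)) ≡⟨ scaled-sieved-gCoeff-∑ ℓ n m (2^ (suc ℓ)) (congB n (+ 5) 6) ⟨
    2^ (suc ℓ) * ([ congB n (+ 5) 6 ] gCoeff ℓ (+ 1) 3 n)          ∎
  case-B : m %ℕ 6 ≡ 1 ⊎ m %ℕ 6 ≡ 3 ⊎ m %ℕ 6 ≡ 5 → ∀ n → χ₆₀ n * lamCoeff ℓ m 6 (4 ℕ.* n) ≡ 0ℚ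
  case-B r-odd n = trans (twisted-lamCoeff-∑ ℓ n m) (∑-zero (suc n) λ d _ → pointwise-m-odd ℓ n m r-odd (regime n d))
  case-C : m %ℕ 6 ≡ 2 ⊎ m %ℕ 6 ≡ 4 → ∀ n → χ₆₀ n * lamCoeff ℓ m 6 (4 ℕ.* n)
           ≡ 2^ ℓ * ([ congB n (+ 1) 6 ] gCoeff ℓ (+ 1) 3 n) + (2^ ℓ * ½) * tCoeff ℓ (+ 1) 6 n
  case-C r≡±2 n = begin
    χ₆₀ n * lamCoeff ℓ m 6 (4 ℕ.* n)                               ≡⟨ twisted-lamCoeff-∑ ℓ n m ⟩
    ∑[ d < suc n ] (χ₆₀ n * lamTerm ℓ n m d)                         ≡⟨ ∑-cong (suc n) (λ d _ → pointwise-m≡±2 ℓ n m r≡±2 (regime n d)) ⟩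
    ∑[ d < suc n ] (2^ ℓ * (𝟙 (congB n (+ 1) 6) * gTerm ℓ n d) + (2^ ℓ * ½) * tTerm ℓ n d)
                                                                   ≡⟨ ∑-+ (suc n) (λ d → 2^ ℓ * (𝟙 (congB n (+ 1) 6) * gTerm ℓ n d)) (λ d → (2^ ℓ * ½) * tTerm ℓ n d) ⟩
    ∑[ d < suc n ] (2^ ℓ * (𝟙 (congB n (+ 1) 6) * gTerm ℓ n d)) + ∑[ d < suc n ] ((2^ ℓ * ½) * tTerm ℓ n d)
                                                                   ≡⟨ cong₂ _+_ (scaled-sieved-gCoeff-∑ ℓ n m (2^ ℓ) (congB n (+ 1) 6)) (scaled-tCoeff-∑ ℓ n m (2^ ℓ * ½)) ⟨
    2^ ℓ * ([ congB n (+ 1) 6 ] gCoeff ℓ (+ 1) 3 n) + (2^ ℓ * ½) * tCoeff ℓ (+ 1) 6 n ∎
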